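{- Let $m\ge1$, let $d_1,\dots,d_m$ be positive integers, $S=\sum_{r=1}^m d_r$ and $\xi=S/2$. (i) If $\gcd(d_1,\dots,d_m)=1$, then $\widetilde W(s,{\bf d}^m)=0$ for every integer $s$ with $-S+1\le s\le -1$; moreover, if $m$ is even and $\xi$ is an integer, then also $\widetilde W(-\xi,{\bf d}^m)=0$. (ii) If $\gcd(d_1,\dots,d_m)=p$, then $\widetilde W(s,{\bf d}^m)=0$ for every integer $s$ not divisible by $p$, and also for $s=-p,-2p,\dots,-S+p$; moreover, if $m$ is even and $\xi$ is an integer, then $\widetilde W(-\xi,{\bf d}^m)=0$.
   Context: For an integer $s\ge0$, $W(s,{\bf d}^m)$ is the coefficient of $t^s$ in $\prod_{r=1}^m(1-t^{d_r})^{ -1}$, i.e. the number of nonnegative integer solutions of $d_1x_1+\dots+d_mx_m=s$. $\widetilde W(\cdot,{\bf d}^m):\mathbb Z\to\mathbb Q$ is the unique function of the form $\sum_{i=0}^{m-1}c_i(s)s^i$ with each $c_i$ periodic that agrees with $W(s,{\bf d}^m)$ for all integers $s\ge0$. -}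

module Defs where

open import Data.Nat as ℕ using (ℕ; zero; suc; _≤?_)
open import Data.Nat.GCD using (gcd)
open import Data.Fin using (Fin)
open import Data.Integer as ℤ using (ℤ; +_)
open import Data.Rational as ℚ using (ℚ; 0ℚ; 1ℚ)
open import Data.Product using (Σ; _×_)
open import Relation.Binary.PropositionalEquality using (_≡_)
open import Relation.Nullary using (does)
open import Data.Bool using (if_then_else_)

ΣFinℕ : (m : ℕ) → (Fin m → ℕ) → ℕ
ΣFinℕ zero    f = 0
ΣFinℕ (suc m) f = f Fin.zero ℕ.+ ΣFinℕ m (λ i → f (Fin.suc i))

ΣFinℚ : (m : ℕ) → (Fin m → ℚ) → ℚ
ΣFinℚ zero    f = 0ℚ
ΣFinℚ (suc m) f = f Fin.zero ℚ.+ ΣFinℚ m (λ i → f (Fin.suc i))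

-- gcd(d_1,…,d_m)  (gcd of the empty family is 0)
gcdFin : (m : ℕ) → (Fin m → ℕ) → ℕ
gcdFin zero    d = 0
gcdFin (suc m) d = gcd (d Fin.zero) (gcdFin m (λ i → d (Fin.suc i)))

ΣUpTo : ℕ → (ℕ → ℕ) → ℕ
ΣUpTo zero    g = g 0
ΣUpTo (suc n) g = ΣUpTo n g ℕ.+ g (suc n)

-- W(s, d^m): number of (x_1,…,x_m) ∈ ℕ^m with d_1 x_1 + … + d_m x_m = s.
-- Computed by splitting on x_1 (x_1 ≤ s suffices since d_1 ≥ 1 in the theorem;
-- in general x_1 ranges over values with d_1 x_1 ≤ s, and for d_1 = 0 this
-- definition is only used under the positivity hypothesis).
W : (m : ℕ) → (Fin m → ℕ) → ℕ → ℕ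
W zero    d s = if does (s ℕ.≟ 0) then 1 else 0
W (suc m) d s =
  ΣUpTo s (λ x → if does (d Fin.zero ℕ.* x ≤? s)
                   then W m (λ i → d (Fin.suc i)) (s ℕ.∸ d Fin.zero ℕ.* x)
                   else 0)

_^ℚ_ : ℚ → ℕ → ℚ
q ^ℚ zero  = 1ℚ
q ^ℚ suc n = q ℚ.* (q ^ℚ n)

ℤtoℚ : ℤ → ℚ
ℤtoℚ z = z ℚ./ 1

ℕtoℚ : ℕ → ℚ
ℕtoℚ n = ℤtoℚ (+ n)

Periodic : (ℤ → ℚ) → Set
Periodic c = Σ ℕ λ L → (0 ℕ.< L) × (∀ s → c (s ℤ.+ + L) ≡ c s)

IsQuasiPoly : (m : ℕ) → (ℤ → ℚ) → Set
IsQuasiPoly m f =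
  Σ (Fin m → ℤ → ℚ) λ c →
    (∀ i → Periodic (c i)) ×
    (∀ s → f s ≡ ΣFinℚ m (λ i → c i s ℚ.* (ℤtoℚ s ^ℚ Data.Fin.toℕ i)))

IsWTilde : (m : ℕ) → (Fin m → ℕ) → (ℤ → ℚ) → Set
IsWTilde m d f = IsQuasiPoly m f × (∀ (s : ℕ) → f (+ s) ≡ ℕtoℚ (W m d s))

EvenN : ℕ → Set
EvenN n = Σ ℕ λ k → n ≡ k ℕ.+ k

{-# OPTIONS --safe #-}
-- A quasi-polynomial of degree < m whose coefficients have period L is killed by Δ_L^m, where
-- Δ_L f s = f (s + L) − f s, and a function killed by a power of Δ_L that vanishes on a half-line
-- vanishes everywhere.  Extend W by 0 to negative s; then W(s) = W(s − d₁) + W′(s) on all of ℤ,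
-- W′ counting with d₂, …, dₘ.  By induction on m, W̃ agrees with this extension on [1 − S, ∞):
-- W̃(s) − W̃(s − d₁) is again killed by a power of Δ_L and eventually equals W′, so by induction it
-- equals W′ on [1 − S + d₁, ∞), and the recursion then carries the agreement of W̃ with W down from
-- large s in steps of d₁.  Hence W̃ vanishes on [1 − S, −1], which contains −ξ and −kp.  Off the
-- multiples of p = gcd, multiply W̃ by the indicator of ℤ ∖ pℤ: choosing L with p ∣ L, the product is
-- still killed by Δ_L^m and vanishes for s ≥ 0, where W does, hence everywhere.
module Submission where

open import Defs
open import Data.Nat as ℕ using (ℕ; _≤_; _<_)
open import Data.Fin using (Fin)
open import Data.Integer as ℤ using (ℤ; +_; -_)
open import Data.Integer.Divisibility using (_∣_)
open import Data.Rational using (ℚ; 0ℚ)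
open import Data.Product using (_×_)
open import Relation.Binary.PropositionalEquality using (_≡_)
open import Relation.Nullary using (¬_)

open import Data.Nat using (zero; suc; z≤n; s≤s; _≤?_)
import Data.Nat.Properties as ℕP
import Data.Nat.Divisibility as ℕD
import Data.Nat.GCD as ℕG
import Data.Nat.Coprimality as Coprime
import Data.Integer.Properties as ℤP
import Data.Integer.Divisibility.Signed as Signed
import Data.Rational as ℚ
import Data.Rational.Properties as ℚP
import Data.Fin as F
import Data.Fin.Properties as FP
open import Data.Bool using (if_then_else_)
open import Data.Empty using (⊥-elim)
open import Data.Product using (Σ; _,_; proj₁; proj₂)
open import Function using (_∘_)
open import Level using (0ℓ)
open import Algebra.Properties.Group ℚP.+-0-group using (x∙y⁻¹≈ε⇒x≈y)
open import Relation.Binary.PropositionalEquality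
  using (refl; sym; trans; cong; cong₂; subst; module ≡-Reasoning)
open import Relation.Nullary using (Dec; does; yes; no)
open import Relation.Nullary.Decidable using (dec⇒maybe; dec-false)
open import Tactic.RingSolver using (solve-∀)
open import Tactic.RingSolver.Core.AlmostCommutativeRing
  using (AlmostCommutativeRing; fromCommutativeRing)
open import Data.Integer.Tactic.RingSolver using () renaming (ring to ℤ-ring)

ℚ-ring : AlmostCommutativeRing 0ℓ 0ℓ
ℚ-ring = fromCommutativeRing ℚP.+-*-commutativeRing (λ q → dec⇒maybe (0ℚ ℚP.≟ q))

p+q-p≡q : ∀ p q → (p ℚ.+ q) ℚ.- p ≡ q
p+q-p≡q = solve-∀ ℚ-ring

p+q-q≡p : ∀ p q → (p ℚ.+ q) ℚ.- q ≡ p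
p+q-q≡p = solve-∀ ℚ-ring

p-[p-q]≡q : ∀ p q → p ℚ.- (p ℚ.- q) ≡ q
p-[p-q]≡q = solve-∀ ℚ-ring


ℤtoℚ≡mkℚ : ∀ z → ℤtoℚ z ≡ ℚ.mkℚ z 0 (Coprime.sym (Coprime.1-coprimeTo ℤ.∣ z ∣))
ℤtoℚ≡mkℚ (+ n)      = ℚP.normalize-coprime (Coprime.sym (Coprime.1-coprimeTo n))
ℤtoℚ≡mkℚ ℤ.-[1+ n ] = cong ℚ.-_ (ℚP.normalize-coprime (Coprime.sym (Coprime.1-coprimeTo (suc n))))

ℤtoℚ-+ : ∀ a b → ℤtoℚ (a ℤ.+ b) ≡ ℤtoℚ a ℚ.+ ℤtoℚ b
ℤtoℚ-+ a b = trans
  (cong (λ z → z ℚ./ 1) (cong₂ ℤ._+_ (sym (ℤP.*-identityʳ a)) (sym (ℤP.*-identityʳ b))))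
  (sym (cong₂ ℚ._+_ (ℤtoℚ≡mkℚ a) (ℤtoℚ≡mkℚ b)))

ℕtoℚ-+ : ∀ a b → ℕtoℚ (a ℕ.+ b) ≡ ℕtoℚ a ℚ.+ ℕtoℚ b
ℕtoℚ-+ a b = ℤtoℚ-+ (+ a) (+ b)

i≤+∣i∣ : ∀ i → i ℤ.≤ + ℤ.∣ i ∣
i≤+∣i∣ (+ n)      = ℤP.≤-refl
i≤+∣i∣ ℤ.-[1+ n ] = ℤ.-≤+

downward-induction : ∀ {ℓ} (P : ℤ → Set ℓ) {T : ℤ} (N : ℤ) (d : ℕ) → 0 < d →
                     (∀ s → N ℤ.≤ s → P s) →
                     (∀ s → T ℤ.≤ s → P (s ℤ.+ + d) → P s) →
                     ∀ s → T ℤ.≤ s → P s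
downward-induction P {T} N d d>0 above step s T≤s = descend ℤ.∣ N ℤ.- s ∣ s T≤s N≤s+∣N-s∣
  where
  descend : ∀ k s → T ℤ.≤ s → N ℤ.≤ s ℤ.+ + k → P s
  descend zero    s T≤s N≤s   = above s (subst (N ℤ.≤_) (ℤP.+-identityʳ s) N≤s)
  descend (suc k) s T≤s N≤s+k = step s T≤s (descend k (s ℤ.+ + d)
    (ℤP.≤-trans T≤s (ℤP.i≤i+j s (+ d)))
    (ℤP.≤-trans N≤s+k (subst (s ℤ.+ + suc k ℤ.≤_) (sym (ℤP.+-assoc s (+ d) (+ k)))
                         (ℤP.+-monoʳ-≤ s (ℤ.+≤+ (ℕP.+-monoˡ-≤ k d>0))))))
  N≤s+∣N-s∣ : N ℤ.≤ s ℤ.+ + ℤ.∣ N ℤ.- s ∣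
  N≤s+∣N-s∣ = ℤP.≤-trans (ℤP.≤-reflexive (N≡s+[N-s] N s)) (ℤP.+-monoʳ-≤ s (i≤+∣i∣ (N ℤ.- s)))
    where
    N≡s+[N-s] : ∀ N s → N ≡ s ℤ.+ (N ℤ.- s)
    N≡s+[N-s] = solve-∀ ℤ-ring


HasPeriod : ℕ → (ℤ → ℚ) → Set
HasPeriod L c = ∀ s → c (s ℤ.+ + L) ≡ c s

HasPeriod-* : ∀ {L c} k → HasPeriod L c → HasPeriod (k ℕ.* L) c
HasPeriod-* {L} {c} zero    _   s = cong c (ℤP.+-identityʳ s)
HasPeriod-* {L} {c} (suc k) per s = begin
  c (s ℤ.+ + (L ℕ.+ k ℕ.* L))        ≡⟨ cong c (shuffle s (+ L) (+ (k ℕ.* L))) ⟩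
  c ((s ℤ.+ + (k ℕ.* L)) ℤ.+ + L)    ≡⟨ per (s ℤ.+ + (k ℕ.* L)) ⟩
  c (s ℤ.+ + (k ℕ.* L))              ≡⟨ HasPeriod-* k per s ⟩
  c s                                ∎
  where
  open ≡-Reasoning
  shuffle : ∀ s a b → s ℤ.+ (a ℤ.+ b) ≡ (s ℤ.+ b) ℤ.+ a
  shuffle = solve-∀ ℤ-ring

HasPeriod-∣ : ∀ {P L c} → P ℕD.∣ L → HasPeriod P c → HasPeriod L c
HasPeriod-∣ (ℕD.divides k refl) = HasPeriod-* k

commonPeriod : ∀ m (c : Fin m → ℤ → ℚ) → (∀ i → Periodic (c i)) → ∀ M → 0 < M →
               Σ ℕ λ L → 0 < L × M ℕD.∣ L × (∀ i → HasPeriod L (c i))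
commonPeriod zero    c per M M>0 = M , M>0 , ℕD.∣-refl , λ ()
commonPeriod (suc m) c per M M>0 with per F.zero
... | P , P>0 , perP with commonPeriod m (c ∘ F.suc) (per ∘ F.suc) (M ℕ.* P) (ℕP.*-mono-≤ M>0 P>0)
...   | L , L>0 , MP∣L , perL = L , L>0 , ℕD.∣-trans (ℕD.m∣m*n P) MP∣L , period
  where
  period : ∀ i → HasPeriod L (c i)
  period F.zero    = HasPeriod-∣ (ℕD.∣-trans (ℕD.n∣m*n M) MP∣L) perP
  period (F.suc i) = perL i


Δ : ℕ → (ℤ → ℚ) → ℤ → ℚ
Δ L f s = f (s ℤ.+ + L) ℚ.- f s

Annihilated : ℕ → ℕ → (ℤ → ℚ) → Set
Annihilated L zero    f = ∀ s → f s ≡ 0ℚ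
Annihilated L (suc n) f = Annihilated L n (Δ L f)

module _ {L : ℕ} where

  annihilated-cong : ∀ n {f g} → (∀ s → f s ≡ g s) → Annihilated L n f → Annihilated L n g
  annihilated-cong zero    f≗g ann s = trans (sym (f≗g s)) (ann s)
  annihilated-cong (suc n) f≗g ann = annihilated-cong n (λ s → cong₂ ℚ._-_ (f≗g _) (f≗g s)) ann

  annihilated-0 : ∀ n → Annihilated L n (λ _ → 0ℚ)
  annihilated-0 zero    s = refl
  annihilated-0 (suc n) = annihilated-0 n

  annihilated-suc : ∀ n {f} → Annihilated L n f → Annihilated L (suc n) f
  annihilated-suc zero    ann s = cong₂ ℚ._-_ (ann _) (ann s)
  annihilated-suc (suc n) ann   = annihilated-suc n ann

  annihilated-≤ : ∀ {n n′ f} → n ≤ n′ → Annihilated L n f → Annihilated L n′ f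
  annihilated-≤ {n′ = zero}   z≤n        ann = ann
  annihilated-≤ {n′ = suc n′} z≤n        ann = annihilated-suc n′ (annihilated-≤ {n′ = n′} z≤n ann)
  annihilated-≤                (s≤s n≤n′) ann = annihilated-≤ n≤n′ ann

  annihilated-+ : ∀ n {f g} → Annihilated L n f → Annihilated L n g → Annihilated L n (λ s → f s ℚ.+ g s)
  annihilated-+ zero    a b s = cong₂ ℚ._+_ (a s) (b s)
  annihilated-+ (suc n) {f} {g} a b =
    annihilated-cong n (λ s → interchange (f (s ℤ.+ + L)) (f s) (g (s ℤ.+ + L)) (g s))
                       (annihilated-+ n {Δ L f} {Δ L g} a b)
    where
    interchange : ∀ a b c d → (a ℚ.- b) ℚ.+ (c ℚ.- d) ≡ (a ℚ.+ c) ℚ.- (b ℚ.+ d)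
    interchange = solve-∀ ℚ-ring

  annihilated-- : ∀ n {f g} → Annihilated L n f → Annihilated L n g → Annihilated L n (λ s → f s ℚ.- g s)
  annihilated-- zero    a b s = cong₂ ℚ._-_ (a s) (b s)
  annihilated-- (suc n) {f} {g} a b =
    annihilated-cong n (λ s → interchange (f (s ℤ.+ + L)) (f s) (g (s ℤ.+ + L)) (g s))
                       (annihilated-- n {Δ L f} {Δ L g} a b)
    where
    interchange : ∀ a b c d → (a ℚ.- b) ℚ.- (c ℚ.- d) ≡ (a ℚ.- c) ℚ.- (b ℚ.- d)
    interchange = solve-∀ ℚ-ring

  annihilated-shift : ∀ n {f} c → Annihilated L n f → Annihilated L n (λ s → f (s ℤ.+ c))
  annihilated-shift zero        c ann s = ann (s ℤ.+ c)
  annihilated-shift (suc n) {f} c ann =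
    annihilated-cong n (λ s → cong (λ z → f z ℚ.- f (s ℤ.+ c)) (comm s (+ L) c))
                       (annihilated-shift n {Δ L f} c ann)
    where
    comm : ∀ s c l → (s ℤ.+ l) ℤ.+ c ≡ (s ℤ.+ c) ℤ.+ l
    comm = solve-∀ ℤ-ring

  annihilated-*-periodic : ∀ n {e f} → HasPeriod L e → Annihilated L n f → Annihilated L n (λ s → e s ℚ.* f s)
  annihilated-*-periodic zero    {e}     per ann s = trans (cong (e s ℚ.*_) (ann s)) (ℚP.*-zeroʳ (e s))
  annihilated-*-periodic (suc n) {e} {f} per ann =
    annihilated-cong n (λ s → trans (distrib (e s) (f (s ℤ.+ + L)) (f s))
                                    (cong (λ z → z ℚ.* f (s ℤ.+ + L) ℚ.- e s ℚ.* f s) (sym (per s))))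
                       (annihilated-*-periodic n {e} {Δ L f} per ann)
    where
    distrib : ∀ p q r → p ℚ.* (q ℚ.- r) ≡ p ℚ.* q ℚ.- p ℚ.* r
    distrib = solve-∀ ℚ-ring

  annihilated-s* : ∀ n {g} → Annihilated L n g → Annihilated L (suc n) (λ s → ℤtoℚ s ℚ.* g s)
  annihilated-s* zero    {g} ann =
    annihilated-suc zero {λ s → ℤtoℚ s ℚ.* g s} (λ s → trans (cong (ℤtoℚ s ℚ.*_) (ann s)) (ℚP.*-zeroʳ (ℤtoℚ s)))
  annihilated-s* (suc n) {g} ann = annihilated-cong (suc n) (λ s → sym (product-rule s))
    (annihilated-+ (suc n) {λ s → ℤtoℚ s ℚ.* Δ L g s} {λ s → ℕtoℚ L ℚ.* g (s ℤ.+ + L)}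
                   (annihilated-s* n {Δ L g} ann)
                   (annihilated-*-periodic (suc n) {λ _ → ℕtoℚ L} (λ _ → refl)
                                           (annihilated-shift (suc n) {g} (+ L) ann)))
    where
    product-rule : ∀ s → Δ L (λ s → ℤtoℚ s ℚ.* g s) s ≡ ℤtoℚ s ℚ.* Δ L g s ℚ.+ ℕtoℚ L ℚ.* g (s ℤ.+ + L)
    product-rule s = trans (cong (λ z → z ℚ.* g (s ℤ.+ + L) ℚ.- ℤtoℚ s ℚ.* g s) (ℤtoℚ-+ s (+ L)))
                           (expand (ℤtoℚ s) (ℕtoℚ L) (g (s ℤ.+ + L)) (g s))
      where
      expand : ∀ x l a b → (x ℚ.+ l) ℚ.* a ℚ.- x ℚ.* b ≡ x ℚ.* (a ℚ.- b) ℚ.+ l ℚ.* a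
      expand = solve-∀ ℚ-ring

  periodic⇒annihilated : ∀ {c} → HasPeriod L c → Annihilated L 1 c
  periodic⇒annihilated {c} per s = trans (cong (ℚ._- c s) (per s)) (ℚP.+-inverseʳ (c s))

  annihilated-monomial : ∀ {c} i → HasPeriod L c → Annihilated L (suc i) (λ s → c s ℚ.* (ℤtoℚ s ^ℚ i))
  annihilated-monomial {c} zero    per = annihilated-cong 1 (λ s → sym (ℚP.*-identityʳ (c s))) (periodic⇒annihilated per)
  annihilated-monomial {c} (suc i) per = annihilated-cong (suc (suc i))
    (λ s → swap (ℤtoℚ s) (c s) (ℤtoℚ s ^ℚ i))
    (annihilated-s* (suc i) {λ s → c s ℚ.* (ℤtoℚ s ^ℚ i)} (annihilated-monomial i per))
    where
    swap : ∀ x c y → x ℚ.* (c ℚ.* y) ≡ c ℚ.* (x ℚ.* y)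
    swap = solve-∀ ℚ-ring

  annihilated-ΣFinℚ : ∀ n m (g : Fin m → ℤ → ℚ) → (∀ i → Annihilated L n (g i)) →
                      Annihilated L n (λ s → ΣFinℚ m (λ i → g i s))
  annihilated-ΣFinℚ n zero    g ann = annihilated-0 n
  annihilated-ΣFinℚ n (suc m) g ann = annihilated-+ n {g F.zero} {λ s → ΣFinℚ m (λ i → g (F.suc i) s)}
    (ann F.zero) (annihilated-ΣFinℚ n m (g ∘ F.suc) (ann ∘ F.suc))

  annihilated-eventually-0⇒0 : ∀ n {f} → 0 < L → Annihilated L n f →
                               ∀ N → (∀ s → N ℤ.≤ s → f s ≡ 0ℚ) → ∀ s → f s ≡ 0ℚ
  annihilated-eventually-0⇒0 zero    L>0 ann N tail = ann
  annihilated-eventually-0⇒0 (suc n) {f} L>0 ann N tail s =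
    downward-induction (λ s → f s ≡ 0ℚ) N L L>0 tail
      (λ s′ _ f[s′+L]≡0 → trans (sym (period s′)) f[s′+L]≡0) s ℤP.≤-refl
    where
    Δf≡0 : ∀ s → Δ L f s ≡ 0ℚ
    Δf≡0 = annihilated-eventually-0⇒0 n L>0 ann N
      (λ s N≤s → trans (cong₂ ℚ._-_ (tail _ (ℤP.≤-trans N≤s (ℤP.i≤i+j s (+ L)))) (tail s N≤s)) refl)
    period : HasPeriod L f
    period s = x∙y⁻¹≈ε⇒x≈y _ _ (Δf≡0 s)

quasiPoly⇒annihilated : ∀ m {f} → IsQuasiPoly m f → ∀ M → 0 < M →
                        Σ ℕ λ L → 0 < L × M ℕD.∣ L × Annihilated L m f
quasiPoly⇒annihilated m {f} (c , per , f≡) M M>0 with commonPeriod m c per M M>0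
... | L , L>0 , M∣L , perL = L , L>0 , M∣L ,
  annihilated-cong m (λ s → sym (f≡ s))
    (annihilated-ΣFinℚ m m (λ i s → c i s ℚ.* (ℤtoℚ s ^ℚ F.toℕ i))
       (λ i → annihilated-≤ (FP.toℕ<n i) (annihilated-monomial (F.toℕ i) (perL i))))


ΣUpTo-cong : ∀ n {g h} → (∀ x → g x ≡ h x) → ΣUpTo n g ≡ ΣUpTo n h
ΣUpTo-cong zero    g≗h = g≗h 0
ΣUpTo-cong (suc n) g≗h = cong₂ ℕ._+_ (ΣUpTo-cong n g≗h) (g≗h (suc n))

ΣUpTo-0 : ∀ n {g} → (∀ x → g x ≡ 0) → ΣUpTo n g ≡ 0
ΣUpTo-0 zero    g≡0 = g≡0 0
ΣUpTo-0 (suc n) g≡0 = cong₂ ℕ._+_ (ΣUpTo-0 n g≡0) (g≡0 (suc n))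

ΣUpTo-sucˡ : ∀ n g → ΣUpTo (suc n) g ≡ g 0 ℕ.+ ΣUpTo n (g ∘ suc)
ΣUpTo-sucˡ zero    g = refl
ΣUpTo-sucˡ (suc n) g = trans (cong (ℕ._+ g (suc (suc n))) (ΣUpTo-sucˡ n g)) (ℕP.+-assoc (g 0) _ _)

ΣUpTo-vanishing-tail : ∀ t {g} → (∀ x → t < x → g x ≡ 0) → ∀ k → ΣUpTo (k ℕ.+ t) g ≡ ΣUpTo t g
ΣUpTo-vanishing-tail t     tail zero    = refl
ΣUpTo-vanishing-tail t {g} tail (suc k) =
  trans (cong₂ ℕ._+_ (ΣUpTo-vanishing-tail t tail k) (tail (suc (k ℕ.+ t)) (s≤s (ℕP.m≤n+m t k))))
        (ℕP.+-identityʳ (ΣUpTo t g))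

if-does-cong : ∀ {P Q : Set} {A : Set} {a b c : A} (p? : Dec P) (q? : Dec Q) → (P → Q) → (Q → P) → (P → a ≡ b) →
               (if does p? then a else c) ≡ (if does q? then b else c)
if-does-cong (yes p) (yes q) P→Q Q→P a≡b = a≡b p
if-does-cong (yes p) (no ¬q) P→Q Q→P a≡b = ⊥-elim (¬q (P→Q p))
if-does-cong (no ¬p) (yes q) P→Q Q→P a≡b = ⊥-elim (¬p (Q→P q))
if-does-cong (no ¬p) (no ¬q) P→Q Q→P a≡b = refl

-- W (suc m) d is definitionally addPart (d F.zero) (W m (d ∘ F.suc)); x counts the parts equal to d₀.
summand : ℕ → (ℕ → ℕ) → ℕ → ℕ → ℕ
summand d₀ w s x = if does (d₀ ℕ.* x ≤? s) then w (s ℕ.∸ d₀ ℕ.* x) else 0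

addPart : ℕ → (ℕ → ℕ) → ℕ → ℕ
addPart d₀ w s = ΣUpTo s (summand d₀ w s)

summand-0 : ∀ d₀ w s → summand d₀ w s 0 ≡ w s
summand-0 d₀ w s rewrite ℕP.*-zeroʳ d₀ = refl

summand-> : ∀ d₀ w s x → s < d₀ ℕ.* x → summand d₀ w s x ≡ 0
summand-> d₀ w s x s<d₀x =
  cong (λ b → if b then w (s ℕ.∸ d₀ ℕ.* x) else 0) (dec-false (d₀ ℕ.* x ≤? s) (ℕP.<⇒≱ s<d₀x))

summand-suc : ∀ d₀ w t x → summand d₀ w (d₀ ℕ.+ t) (suc x) ≡ summand d₀ w t x
summand-suc d₀ w t x = if-does-cong (d₀ ℕ.* suc x ≤? d₀ ℕ.+ t) (d₀ ℕ.* x ≤? t)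
  (λ le → ℕP.+-cancelˡ-≤ d₀ _ _ (subst (_≤ d₀ ℕ.+ t) (ℕP.*-suc d₀ x) le))
  (λ le → subst (_≤ d₀ ℕ.+ t) (sym (ℕP.*-suc d₀ x)) (ℕP.+-monoʳ-≤ d₀ le))
  (λ _ → cong w (trans (cong (d₀ ℕ.+ t ℕ.∸_) (ℕP.*-suc d₀ x)) (ℕP.[m+n]∸[m+o]≡n∸o d₀ t (d₀ ℕ.* x))))

addPart-< : ∀ {d₀ s} w → s < d₀ → addPart d₀ w s ≡ w s
addPart-< {d₀} {s} w s<d₀ = begin
  ΣUpTo s (summand d₀ w s)           ≡⟨ cong (λ n → ΣUpTo n (summand d₀ w s)) (sym (ℕP.+-identityʳ s)) ⟩
  ΣUpTo (s ℕ.+ 0) (summand d₀ w s)   ≡⟨ ΣUpTo-vanishing-tail 0 beyond-0 s ⟩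
  summand d₀ w s 0                   ≡⟨ summand-0 d₀ w s ⟩
  w s                                ∎
  where
  open ≡-Reasoning
  beyond-0 : ∀ x → 0 < x → summand d₀ w s x ≡ 0
  beyond-0 x 0<x = summand-> d₀ w s x (ℕP.<-≤-trans s<d₀ (ℕP.m≤m*n d₀ x {{ℕ.>-nonZero 0<x}}))

addPart-+ : ∀ {d₀} → 0 < d₀ → ∀ w t → addPart d₀ w (d₀ ℕ.+ t) ≡ addPart d₀ w t ℕ.+ w (d₀ ℕ.+ t)
addPart-+ {suc e} _ w t = begin
  ΣUpTo (suc (e ℕ.+ t)) g                           ≡⟨ ΣUpTo-sucˡ (e ℕ.+ t) g ⟩
  g 0 ℕ.+ ΣUpTo (e ℕ.+ t) (g ∘ suc)
    ≡⟨ cong₂ ℕ._+_ (summand-0 (suc e) w (suc e ℕ.+ t)) (ΣUpTo-cong (e ℕ.+ t) (summand-suc (suc e) w t)) ⟩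
  w (suc e ℕ.+ t) ℕ.+ ΣUpTo (e ℕ.+ t) (summand (suc e) w t)
    ≡⟨ cong (w (suc e ℕ.+ t) ℕ.+_) (ΣUpTo-vanishing-tail t beyond-t e) ⟩
  w (suc e ℕ.+ t) ℕ.+ addPart (suc e) w t           ≡⟨ ℕP.+-comm (w (suc e ℕ.+ t)) _ ⟩
  addPart (suc e) w t ℕ.+ w (suc e ℕ.+ t)           ∎
  where
  open ≡-Reasoning
  g : ℕ → ℕ
  g = summand (suc e) w (suc e ℕ.+ t)
  beyond-t : ∀ x → t < x → summand (suc e) w t x ≡ 0
  beyond-t x t<x = summand-> (suc e) w t x (ℕP.<-≤-trans t<x (ℕP.m≤n*m x (suc e)))

addPart-vanishes : ∀ {p d₀ w} → p ℕD.∣ d₀ → (∀ n → ¬ p ℕD.∣ n → w n ≡ 0) →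
                   ∀ n → ¬ p ℕD.∣ n → addPart d₀ w n ≡ 0
addPart-vanishes {p} {d₀} {w} p∣d₀ w-vanishes n p∤n = ΣUpTo-0 n (λ x → if-does-0 (d₀ ℕ.* x ≤? n)
  (λ d₀x≤n → w-vanishes (n ℕ.∸ d₀ ℕ.* x)
     (λ p∣n-d₀x → p∤n (ℕD.∣m∸n∣n⇒∣m p d₀x≤n p∣n-d₀x (ℕD.∣-trans p∣d₀ (ℕD.m∣m*n x))))))
  where
  if-does-0 : ∀ {P : Set} {a : ℕ} (p? : Dec P) → (P → a ≡ 0) → (if does p? then a else 0) ≡ 0
  if-does-0 (yes p) a≡0 = a≡0 p
  if-does-0 (no _)  _   = refl

W-vanishes : ∀ m d p → (∀ i → p ℕD.∣ d i) → ∀ n → ¬ p ℕD.∣ n → W m d n ≡ 0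
W-vanishes zero    d p p∣d zero    p∤n = ⊥-elim (p∤n (p ℕD.∣0))
W-vanishes zero    d p p∣d (suc n) p∤n = refl
W-vanishes (suc m) d p p∣d = addPart-vanishes (p∣d F.zero) (W-vanishes m (d ∘ F.suc) p (p∣d ∘ F.suc))


extend : (ℕ → ℕ) → ℤ → ℚ
extend w (+ n)      = ℕtoℚ (w n)
extend w ℤ.-[1+ n ] = 0ℚ

extend-addPart : ∀ {d₀} → 0 < d₀ → ∀ w s →
                 extend (addPart d₀ w) s ≡ extend (addPart d₀ w) (s ℤ.- + d₀) ℚ.+ extend w s
extend-addPart {suc e} _ w ℤ.-[1+ n ] = refl
extend-addPart {d₀} d₀>0 w (+ a) with a ℕ.<? d₀
... | yes a<d₀ = begin
  ℕtoℚ (addPart d₀ w a)                                  ≡⟨ cong ℕtoℚ (addPart-< w a<d₀) ⟩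
  ℕtoℚ (w a)                                             ≡⟨ ℚP.+-identityˡ (ℕtoℚ (w a)) ⟨
  0ℚ ℚ.+ ℕtoℚ (w a)
    ≡⟨ cong (λ z → extend (addPart d₀ w) z ℚ.+ ℕtoℚ (w a)) a-d₀-negative ⟨
  extend (addPart d₀ w) (+ a ℤ.- + d₀) ℚ.+ ℕtoℚ (w a)    ∎
  where
  open ≡-Reasoning
  a-d₀-negative : + a ℤ.- + d₀ ≡ ℤ.-[1+ d₀ ℕ.∸ suc a ]
  a-d₀-negative = trans (ℤP.[+m]-[+n]≡m⊖n a d₀) (trans (ℤP.⊖-< a<d₀) (cong (λ k → - (+ k)) (ℕP.+-∸-assoc 1 a<d₀)))
... | no a≮d₀ with ℕP.m≤n⇒∃[o]m+o≡n (ℕP.≮⇒≥ a≮d₀)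
...   | t , refl = begin
  ℕtoℚ (addPart d₀ w (d₀ ℕ.+ t))                                   ≡⟨ cong ℕtoℚ (addPart-+ d₀>0 w t) ⟩
  ℕtoℚ (addPart d₀ w t ℕ.+ w (d₀ ℕ.+ t))                           ≡⟨ ℕtoℚ-+ (addPart d₀ w t) (w (d₀ ℕ.+ t)) ⟩
  extend (addPart d₀ w) (+ t) ℚ.+ ℕtoℚ (w (d₀ ℕ.+ t))
    ≡⟨ cong (λ z → extend (addPart d₀ w) z ℚ.+ ℕtoℚ (w (d₀ ℕ.+ t))) d₀+t-d₀≡t ⟨
  extend (addPart d₀ w) (+ (d₀ ℕ.+ t) ℤ.- + d₀) ℚ.+ ℕtoℚ (w (d₀ ℕ.+ t)) ∎
  where
  open ≡-Reasoning
  d₀+t-d₀≡t : + (d₀ ℕ.+ t) ℤ.- + d₀ ≡ + t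
  d₀+t-d₀≡t = trans (ℤP.[+m]-[+n]≡m⊖n (d₀ ℕ.+ t) d₀)
                (trans (ℤP.⊖-≥ (ℕP.m≤m+n d₀ t)) (cong +_ (ℕP.m+n∸m≡n d₀ t)))

Wℤ : (m : ℕ) → (Fin m → ℕ) → ℤ → ℚ
Wℤ m d = extend (W m d)

Wℤ-suc : ∀ m d → 0 < d F.zero → ∀ s → Wℤ (suc m) d s ≡ Wℤ (suc m) d (s ℤ.- + d F.zero) ℚ.+ Wℤ m (d ∘ F.suc) s
Wℤ-suc m d d₀>0 = extend-addPart d₀>0 (W m (d ∘ F.suc))

Wℤ-0-positive : ∀ d s → + 1 ℤ.≤ s → Wℤ 0 d s ≡ 0ℚ
Wℤ-0-positive d (+ zero)  (ℤ.+≤+ ())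
Wℤ-0-positive d (+ suc n) _ = refl

[i+j]-j≡i : ∀ i j → (i ℤ.+ j) ℤ.- j ≡ i
[i+j]-j≡i = solve-∀ ℤ-ring

eventually-Wℤ⇒Wℤ-from-1-S : ∀ m d → (∀ i → 0 < d i) → ∀ {L} n {f} → 0 < L → Annihilated L n f →
                            ∀ N → (∀ s → N ℤ.≤ s → f s ≡ Wℤ m d s) →
                            ∀ s → - (+ ΣFinℕ m d) ℤ.+ + 1 ℤ.≤ s → f s ≡ Wℤ m d s
eventually-Wℤ⇒Wℤ-from-1-S zero d d>0 n {f} L>0 ann N agree s 1≤s =
  trans (f≡0 s) (sym (Wℤ-0-positive d s 1≤s))
  where
  f≡0 : ∀ s → f s ≡ 0ℚ
  f≡0 = annihilated-eventually-0⇒0 n L>0 ann (N ℤ.⊔ + 1) λ s N⊔1≤s →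
    trans (agree s (ℤP.≤-trans (ℤP.i≤i⊔j N (+ 1)) N⊔1≤s))
          (Wℤ-0-positive d s (ℤP.≤-trans (ℤP.i≤j⊔i N (+ 1)) N⊔1≤s))
eventually-Wℤ⇒Wℤ-from-1-S (suc m) d d>0 {L} n {f} L>0 ann N agree =
  downward-induction (λ s → f s ≡ Wℤ (suc m) d s) N d₀ (d>0 F.zero) agree step
  where
  open ≡-Reasoning
  d₀ : ℕ
  d₀ = d F.zero
  d′ : Fin m → ℕ
  d′ = d ∘ F.suc
  S′ : ℕ
  S′ = ΣFinℕ m d′
  V V′ : ℤ → ℚ
  V  = Wℤ (suc m) d
  V′ = Wℤ m d′

  h : ℤ → ℚ
  h s = f s ℚ.- f (s ℤ.- + d₀)

  h-agrees : ∀ s → N ℤ.+ + d₀ ℤ.≤ s → h s ≡ V′ s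
  h-agrees s N+d₀≤s = begin
    f s ℚ.- f (s ℤ.- + d₀)                           ≡⟨ cong₂ ℚ._-_ (agree s N≤s) (agree (s ℤ.- + d₀) N≤s-d₀) ⟩
    V s ℚ.- V (s ℤ.- + d₀)                           ≡⟨ cong (ℚ._- V (s ℤ.- + d₀)) (Wℤ-suc m d (d>0 F.zero) s) ⟩
    (V (s ℤ.- + d₀) ℚ.+ V′ s) ℚ.- V (s ℤ.- + d₀)     ≡⟨ p+q-p≡q (V (s ℤ.- + d₀)) (V′ s) ⟩
    V′ s                                             ∎
    where
    N≤s : N ℤ.≤ s
    N≤s = ℤP.≤-trans (ℤP.i≤i+j N (+ d₀)) N+d₀≤s
    N≤s-d₀ : N ℤ.≤ s ℤ.- + d₀
    N≤s-d₀ = subst (ℤ._≤ s ℤ.- + d₀) ([i+j]-j≡i N (+ d₀)) (ℤP.+-monoˡ-≤ (- + d₀) N+d₀≤s)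

  h-from-1-S′ : ∀ s → - (+ S′) ℤ.+ + 1 ℤ.≤ s → h s ≡ V′ s
  h-from-1-S′ = eventually-Wℤ⇒Wℤ-from-1-S m d′ (d>0 ∘ F.suc) n L>0
    (annihilated-- n {f} {λ s → f (s ℤ.- + d₀)} ann (annihilated-shift n (- + d₀) ann)) (N ℤ.+ + d₀) h-agrees

  step : ∀ s → - (+ (d₀ ℕ.+ S′)) ℤ.+ + 1 ℤ.≤ s → f (s ℤ.+ + d₀) ≡ V (s ℤ.+ + d₀) → f s ≡ V s
  step s 1-S≤s f≡V = begin
    f s                                      ≡⟨ cong f ([i+j]-j≡i s (+ d₀)) ⟨
    f (u ℤ.- + d₀)                           ≡⟨ p-[p-q]≡q (f u) (f (u ℤ.- + d₀)) ⟨
    f u ℚ.- h u                              ≡⟨ cong₂ ℚ._-_ f≡V (h-from-1-S′ u 1-S′≤u) ⟩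
    V u ℚ.- V′ u                             ≡⟨ cong (ℚ._- V′ u) (Wℤ-suc m d (d>0 F.zero) u) ⟩
    (V (u ℤ.- + d₀) ℚ.+ V′ u) ℚ.- V′ u       ≡⟨ p+q-q≡p (V (u ℤ.- + d₀)) (V′ u) ⟩
    V (u ℤ.- + d₀)                           ≡⟨ cong V ([i+j]-j≡i s (+ d₀)) ⟩
    V s                                      ∎
    where
    u : ℤ
    u = s ℤ.+ + d₀
    shift-bound : ∀ a b c → (- (a ℤ.+ b) ℤ.+ c) ℤ.+ a ≡ - b ℤ.+ c
    shift-bound = solve-∀ ℤ-ring
    1-S′≤u : - (+ S′) ℤ.+ + 1 ℤ.≤ u
    1-S′≤u = subst (ℤ._≤ u)
      (trans (cong (λ z → (- z ℤ.+ + 1) ℤ.+ + d₀) (ℤP.pos-+ d₀ S′)) (shift-bound (+ d₀) (+ S′) (+ 1)))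
      (ℤP.+-monoˡ-≤ (+ d₀) 1-S≤s)


gcdFin-∣ : ∀ m d i → gcdFin m d ℕD.∣ d i
gcdFin-∣ (suc m) d F.zero    = ℕG.gcd[m,n]∣m (d F.zero) (gcdFin m (d ∘ F.suc))
gcdFin-∣ (suc m) d (F.suc i) =
  ℕD.∣-trans (ℕG.gcd[m,n]∣n (d F.zero) (gcdFin m (d ∘ F.suc))) (gcdFin-∣ m (d ∘ F.suc) i)

gcdFin-pos : ∀ m d → 1 ≤ m → (∀ i → 0 < d i) → 0 < gcdFin m d
gcdFin-pos (suc m) d _ d>0 = ℕP.n≢0⇒n>0 λ gcd≡0 →
  ℕP.<⇒≢ (d>0 F.zero) (sym (ℕD.0∣⇒≡0 (subst (ℕD._∣ d F.zero) gcd≡0 (gcdFin-∣ (suc m) d F.zero))))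

ΣFinℕ-pos : ∀ m d → 1 ≤ m → (∀ i → 0 < d i) → 0 < ΣFinℕ m d
ΣFinℕ-pos (suc m) d _ d>0 = ℕP.<-≤-trans (d>0 F.zero) (ℕP.m≤m+n (d F.zero) _)

module _ {m : ℕ} {d : Fin m → ℕ} (d>0 : ∀ i → 0 < d i) {f : ℤ → ℚ} (W̃ : IsWTilde m d f) where

  W̃-vanishes-on-window : ∀ s → - (+ ΣFinℕ m d) ℤ.+ + 1 ℤ.≤ s → s ℤ.≤ - (+ 1) → f s ≡ 0ℚ
  W̃-vanishes-on-window s 1-S≤s s≤-1 with quasiPoly⇒annihilated m (proj₁ W̃) 1 (s≤s z≤n)
  ... | L , L>0 , _ , ann = trans (eventually-Wℤ⇒Wℤ-from-1-S m d d>0 m L>0 ann (+ 0) agree-from-0 s 1-S≤s) (Wℤ-neg s s≤-1)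
    where
    agree-from-0 : ∀ s → + 0 ℤ.≤ s → f s ≡ Wℤ m d s
    agree-from-0 (+ n) _ = proj₂ W̃ n
    Wℤ-neg : ∀ s → s ℤ.≤ - (+ 1) → Wℤ m d s ≡ 0ℚ
    Wℤ-neg ℤ.-[1+ n ] _ = refl

  W̃-vanishes-at-neg : ∀ j → 1 ≤ j → j < ΣFinℕ m d → f (- (+ j)) ≡ 0ℚ
  W̃-vanishes-at-neg (suc a) _ j<S = W̃-vanishes-on-window (- (+ suc a)) (window j<S) (ℤ.-≤- z≤n)
    where
    window : ∀ {S} → suc a < S → - (+ S) ℤ.+ + 1 ℤ.≤ - (+ suc a)
    window {suc (suc c)} (s≤s (s≤s a≤c)) = ℤ.-≤- a≤c

  W̃-vanishes-off-multiples : 1 ≤ m → ∀ s → ¬ (+ gcdFin m d ∣ s) → f s ≡ 0ℚ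
  W̃-vanishes-off-multiples 1≤m s p∤s with quasiPoly⇒annihilated m (proj₁ W̃) (gcdFin m d) (gcdFin-pos m d 1≤m d>0)
  ... | L , L>0 , p∣L , ann = trans (sym (mask-one (+ p Signed.∣? s) (p∤s ∘ Signed.∣⇒∣ᵤ))) (masked≡0 s)
    where
    p : ℕ
    p = gcdFin m d

    mask : ℤ → ℚ
    mask s = if does (+ p Signed.∣? s) then 0ℚ else ℚ.1ℚ

    mask-one : ∀ {P : Set} {x} (p? : Dec P) → ¬ P → (if does p? then 0ℚ else ℚ.1ℚ) ℚ.* x ≡ x
    mask-one (yes p)      ¬p = ⊥-elim (¬p p)
    mask-one {x = x} (no _) _ = ℚP.*-identityˡ x

    mask-kills : ∀ {P : Set} {x} (p? : Dec P) → (¬ P → x ≡ 0ℚ) → (if does p? then 0ℚ else ℚ.1ℚ) ℚ.* x ≡ 0ℚ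
    mask-kills {x = x} (yes _) _   = ℚP.*-zeroˡ x
    mask-kills {x = x} (no ¬p) x≡0 = trans (ℚP.*-identityˡ x) (x≡0 ¬p)

    mask-period : HasPeriod L mask
    mask-period s = if-does-cong (+ p Signed.∣? (s ℤ.+ + L)) (+ p Signed.∣? s)
      (λ p∣s+L → Signed.∣m+n∣n⇒∣m p∣s+L (Signed.∣ᵤ⇒∣ p∣L))
      (λ p∣s → Signed.∣m∣n⇒∣m+n p∣s (Signed.∣ᵤ⇒∣ p∣L))
      (λ _ → refl)

    masked≡0 : ∀ s → mask s ℚ.* f s ≡ 0ℚ
    masked≡0 = annihilated-eventually-0⇒0 m L>0 (annihilated-*-periodic m mask-period ann) (+ 0) λ where
      (+ n) _ → mask-kills (+ p Signed.∣? + n)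
        (λ p∤n → trans (proj₂ W̃ n) (cong ℕtoℚ (W-vanishes m d p (gcdFin-∣ m d) n (p∤n ∘ Signed.∣ᵤ⇒∣))))

lemma4p3 : (m : ℕ) → 1 ≤ m → (d : Fin m → ℕ) → (∀ i → 0 < d i) →
           (f : ℤ → ℚ) → IsWTilde m d f →
           -- (i)
           ((gcdFin m d ≡ 1 →
               (∀ (s : ℤ) → (ℤ.- (+ ΣFinℕ m d)) ℤ.+ (+ 1) ℤ.≤ s → s ℤ.≤ ℤ.- (+ 1) → f s ≡ 0ℚ)
             × (EvenN m → ∀ (ξ : ℕ) → ΣFinℕ m d ≡ ξ ℕ.+ ξ → f (ℤ.- (+ ξ)) ≡ 0ℚ))
           -- (ii)
           × (∀ (p : ℕ) → gcdFin m d ≡ p →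
               (∀ (s : ℤ) → ¬ (+ p ∣ s) → f s ≡ 0ℚ)
             × (∀ (k : ℕ) → 1 ≤ k → k ℕ.* p ℕ.+ p ≤ ΣFinℕ m d → f (ℤ.- (+ (k ℕ.* p))) ≡ 0ℚ)
             × (EvenN m → ∀ (ξ : ℕ) → ΣFinℕ m d ≡ ξ ℕ.+ ξ → f (ℤ.- (+ ξ)) ≡ 0ℚ)))
lemma4p3 m 1≤m d d>0 f W̃ =
  (λ _ → W̃-vanishes-on-window d>0 W̃ , λ _ → at-half) ,
  λ p gcd≡p → subst (λ p → ∀ s → ¬ (+ p ∣ s) → f s ≡ 0ℚ) gcd≡p (W̃-vanishes-off-multiples d>0 W̃ 1≤m) ,
              at-multiple p (subst (0 <_) gcd≡p (gcdFin-pos m d 1≤m d>0)) ,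
              λ _ → at-half
  where
  -- Neither the parity of m nor the value of the gcd is needed for the vanishing on [1 − S, −1].
  at-half : ∀ ξ → ΣFinℕ m d ≡ ξ ℕ.+ ξ → f (- (+ ξ)) ≡ 0ℚ
  at-half zero    S≡0   = ⊥-elim (ℕP.<⇒≢ (ΣFinℕ-pos m d 1≤m d>0) (sym S≡0))
  at-half (suc ξ) S≡ξ+ξ = W̃-vanishes-at-neg d>0 W̃ (suc ξ) (s≤s z≤n)
    (subst (suc ξ <_) (sym S≡ξ+ξ) (ℕP.m<m+n (suc ξ) (s≤s z≤n)))

  at-multiple : ∀ p → 0 < p → ∀ k → 1 ≤ k → k ℕ.* p ℕ.+ p ≤ ΣFinℕ m d → f (- (+ (k ℕ.* p))) ≡ 0ℚ
  at-multiple p p>0 k 1≤k kp+p≤S = W̃-vanishes-at-neg d>0 W̃ (k ℕ.* p) (ℕP.*-mono-≤ 1≤k p>0)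
    (ℕP.<-≤-trans (ℕP.m<m+n (k ℕ.* p) p>0) kp+p≤S)
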